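{- Fix a permutation $\tau$ of the setup operations. Let $\pi$ be any feasible schedule that is in generalized weighted SPT-order and whose setup operations appear in the order $\tau$. Then there are moves $\sigma_1,\dots,\sigma_n$, with $\sigma_k$ a move of the $k$-th job in weighted SPT-order, such that applying $\sigma_1,\dots,\sigma_n$ in this order to $\pi^{\mathrm{init}}_\tau$ yields $\pi$. Moreover, each intermediate schedule obtained after applying $\sigma_1,\dots,\sigma_k$ is in generalized weighted SPT-order.
   Context: One-time setup problem, glued form: jobs $j_1,\dots,j_n$, each a single operation with processing time $p(j)\ge0$ and weight $w(j)\ge0$, and requiring a set of families from $\{f_1,\dots,f_K\}$. For each family $f$ there is a setup operation $o^s_f$ of processing time $s(f)\ge0$ and weight $0$. A feasible schedule is a permutation of all jobs and setup operations such that each job is preceded by the setup operations of all families it requires. Completion times are prefix sums of processing times, and the objective is $\sum_j w(j)C_j$. A job cannot be scheduled at a position if some setup operation it requires does not occur before that position. Weighted SPT-order: nondecreasing $p(j)/w(j)$, with ties broken by lower index. Generalized weighted SPT-order of a schedule: (i) whenever $p(j_i)/w(j_i)<p(j_k)/w(j_k)$, either $j_i$ precedes $j_k$, or $j_i$ cannot be scheduled at $j_k$'s position; (ii) whenever the ratios are equal, with $a=\min\{i,k\}$ and $b=\max\{i,k\}$, either $j_a$ precedes $j_b$, or $j_a$ cannot be scheduled at $j_b$'s position. $\pi^{\mathrm{init}}_\tau$ is the schedule consisting of the setup operations in order $\tau$ followed by all jobs in weighted SPT-order. A block is a maximal sequence of consecutive jobs between setup operations. Schedules considered keep setup order $\tau$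 and jobs within each block in weighted SPT-order. A move of job $j$ is the choice of a block into which $j$ is placed (at the position dictated by weighted SPT-order within the block) such that the resulting schedule is feasible. -}

module Defs where

open import Data.Nat using (ℕ; zero; suc; _+_; _*_; _<_; _≤_; _<ᵇ_; _≡ᵇ_)
open import Data.Bool using (Bool; true; false; _∧_; _∨_; not; if_then_else_; T)
open import Data.Fin using (Fin; toℕ; _≟_)
open import Data.List using (List; []; _∷_; _++_; map; take; length; foldr; allFin)
open import Data.List.Membership.Propositional using (_∈_)
open import Data.List.Relation.Binary.Permutation.Propositional using (_↭_)
open import Data.Sum using (_⊎_; inj₁; inj₂)
open import Data.Product using (_×_; ∃; Σ; _,_)
open import Relation.Nullary using (¬_; does)
open import Relation.Binary.PropositionalEquality using (_≡_)

-- An operation is either a job (inj₁ j, j : Fin n) or a setup operation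
-- o^s_f (inj₂ f, f : Fin K).
Op : ℕ → ℕ → Set
Op n K = Fin n ⊎ Fin K

Schedule : ℕ → ℕ → Set
Schedule n K = List (Op n K)

-- Problem instance: processing times p, weights w of the jobs, and the set of
-- families required by each job (req j f ≡ true iff job j requires family f).
-- Setup times s(f) play no role in the statement (only in completion times),
-- so they are not parameters here.
module Sched {n K : ℕ} (p w : Fin n → ℕ) (req : Fin n → Fin K → Bool) where

  -- Ratio comparison p(i)/w(i) < p(k)/w(k) over [0,∞], with the convention
  -- that x/0 = ∞ (for every x ≥ 0).
  ratioLtᵇ : Fin n → Fin n → Bool
  ratioLtᵇ i k = (0 <ᵇ w i) ∧ ((w k ≡ᵇ 0) ∨ (p i * w k <ᵇ p k * w i))

  ratioEqᵇ : Fin n → Fin n → Bool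
  ratioEqᵇ i k = ((w i ≡ᵇ 0) ∧ (w k ≡ᵇ 0))
               ∨ ((0 <ᵇ w i) ∧ (0 <ᵇ w k) ∧ (p i * w k ≡ᵇ p k * w i))

  sptBeforeᵇ : Fin n → Fin n → Bool
  sptBeforeᵇ i k = ratioLtᵇ i k ∨ (ratioEqᵇ i k ∧ (toℕ i <ᵇ toℕ k))

  SptBefore : Fin n → Fin n → Set
  SptBefore i k = T (sptBeforeᵇ i k)

  insertSpt : Fin n → List (Fin n) → List (Fin n)
  insertSpt j [] = j ∷ []
  insertSpt j (x ∷ xs) = if sptBeforeᵇ j x then j ∷ x ∷ xs else x ∷ insertSpt j xs

  sptOrder : List (Fin n)
  sptOrder = foldr insertSpt [] (allFin n)

  allOps : Schedule n K
  allOps = map inj₁ (allFin n) ++ map inj₂ (allFin K)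

  IsPermSchedule : Schedule n K → Set
  IsPermSchedule π = π ↭ allOps

  CannotBeScheduledAfter : Fin n → Schedule n K → Set
  CannotBeScheduledAfter j xs = ∃ λ f → T (req j f) × ¬ (inj₂ f ∈ xs)

  Feasible : Schedule n K → Set
  Feasible π = ∀ (xs : Schedule n K) (j : Fin n) (ys : Schedule n K) →
    π ≡ xs ++ inj₁ j ∷ ys → ∀ f → T (req j f) → inj₂ f ∈ xs

  GenSPT : Schedule n K → Set
  GenSPT π = ∀ (i k : Fin n) → SptBefore i k →
    ∀ (xs ys : Schedule n K) → π ≡ xs ++ inj₁ k ∷ ys →
    inj₁ i ∈ xs ⊎ CannotBeScheduledAfter i xs

  setups : Schedule n K → List (Fin K)
  setups [] = []
  setups (inj₁ _ ∷ π) = setups π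
  setups (inj₂ f ∷ π) = f ∷ setups π

  πinit : List (Fin K) → Schedule n K
  πinit τ = map inj₂ τ ++ map inj₁ sptOrder

  removeJob : Fin n → Schedule n K → Schedule n K
  removeJob j [] = []
  removeJob j (inj₁ x ∷ π) = if does (j ≟ x) then removeJob j π else inj₁ x ∷ removeJob j π
  removeJob j (inj₂ f ∷ π) = inj₂ f ∷ removeJob j π

  -- Insert job j into block number b (b = number of setup operations
  -- preceding the block; blocks are the K+1 possibly-empty maximal runs of
  -- jobs between setups), at the position dictated by weighted SPT-order
  -- within the block.
  insertInBlock : Fin n → ℕ → Schedule n K → Schedule n K
  insertInBlock j b [] = inj₁ j ∷ []
  insertInBlock j zero (inj₂ f ∷ π) = inj₁ j ∷ inj₂ f ∷ π
  insertInBlock j (suc b) (inj₂ f ∷ π) = inj₂ f ∷ insertInBlock j b π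
  insertInBlock j zero (inj₁ x ∷ π) =
    if sptBeforeᵇ j x then inj₁ j ∷ inj₁ x ∷ π else inj₁ x ∷ insertInBlock j zero π
  insertInBlock j (suc b) (inj₁ x ∷ π) = inj₁ x ∷ insertInBlock j (suc b) π

  move : Fin n → Fin (suc K) → Schedule n K → Schedule n K
  move j b π = insertInBlock j (toℕ b) (removeJob j π)

  applyMoves : (Fin n → Fin (suc K)) → List (Fin n) → Schedule n K → Schedule n K
  applyMoves β [] π = π
  applyMoves β (j ∷ js) π = applyMoves β js (move j (β j) π)

module Submission where

-- The block assignment g of a schedule sends each job to the number of setup operations before
-- it.  A schedule with setup order τ whose blocks are in weighted SPT-order is determined by g;
-- call it arrange τ g.  Then π^init_τ = arrange τ (const |τ|), and moving job j into block b turns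
-- arrange τ g into arrange τ (g [ j ↦ b ]).  The given π is arrange τ target for its own block
-- assignment target: two adjacent jobs of one block in the wrong order would make the later job,
-- by generalized weighted SPT-order, miss a setup that feasibility provides.  Moving the jobs to
-- their blocks in π one by one in weighted SPT-order, the k-th intermediate schedule is
-- arrange τ (stage k), where stage k agrees with target on the first k jobs and puts the others
-- in the last block.  Feasibility and generalized weighted SPT-order of arrange τ g are
-- conditions on g alone, and they pass from target to stage k because the jobs not yet moved
-- sit in the last block and come after the moved ones in weighted SPT-order.

open import Defs
open import Data.Nat using (ℕ; zero; suc; _*_; _≤_; _<_; _≤?_; _<?_; _≟_; _≡ᵇ_; z≤n; s≤s)
open import Data.Nat.Properties
open import Data.Bool using (Bool; true; false; T; if_then_else_)
open import Data.Empty using (⊥-elim)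
open import Data.Unit using (tt)
open import Data.Fin using (Fin; toℕ; fromℕ<)
import Data.Fin as F
open import Data.Fin.Properties using (toℕ-injective; toℕ-fromℕ<)
open import Data.List using (List; []; _∷_; _∷ʳ_; _++_; map; foldr; filter; length; take; drop; allFin)
open import Data.List.Properties using (++-assoc; ++-identityʳ; ∷ʳ-++; take++drop≡id; take-all; length-tabulate; ∷-injective; filter-≐; filter-all; filter-none)
open import Data.List.Membership.Propositional using (_∈_; _∉_)
open import Data.List.Membership.Propositional.Properties using (∈-++⁺ˡ; ∈-++⁺ʳ; ∈-++⁻; ∈-map⁺; ∈-map⁻; ∈-filter⁺; ∈-filter⁻; ∈-∃++; ∈-allFin)
open import Data.List.Relation.Unary.Unique.Propositional using (Unique)
import Data.List.Relation.Unary.Unique.Propositional.Properties as Uniqueₚ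
open Uniqueₚ using (allFin⁺)
open import Data.List.Relation.Binary.Permutation.Propositional using (_↭_; ↭-sym; ↭⇒↭ₛ)
open import Data.List.Relation.Binary.Permutation.Propositional.Properties using (∈-resp-↭; ↭-length)
open import Data.List.Relation.Unary.Any using (here; there)
open import Data.List.Relation.Unary.All as All using (All; []; _∷_)
open import Data.List.Relation.Unary.AllPairs using (AllPairs; []; _∷_)
import Data.List.Relation.Unary.AllPairs.Properties as AllPairs
open import Data.List.Relation.Unary.Linked using (Linked; []; [-]; _∷_)
open import Data.List.Relation.Unary.Linked.Properties using (Linked⇒AllPairs)
open import Data.Product using (Σ; _×_; _,_; proj₁; proj₂; ∃; ∃₂)
open import Data.Sum.Properties using (inj₁-injective; inj₂-injective)
open import Data.Sum as Sum using (_⊎_; inj₁; inj₂; [_,_])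
open import Function using (_∘_; id; const; case_of_; _⇔_; mk⇔; Equivalence)
open import Relation.Binary using (Rel; Asymmetric; tri<; tri≈; tri>)
open import Relation.Binary.PropositionalEquality using (_≡_; _≢_; refl; sym; trans; cong; cong₂; subst; subst₂; setoid; module ≡-Reasoning)
open import Relation.Nullary using (¬_; ¬?; Dec; does; yes; no; contradiction)
open import Relation.Nullary.Decidable using (_×-dec_; _⊎-dec_; toSum)
open import Relation.Nullary.Reflects using (Reflects; ofʸ; ofⁿ; fromEquivalence; _×-reflects_; _⊎-reflects_)
open import Algebra.Properties.CommutativeSemigroup *-commutativeSemigroup using (xy∙z≈xz∙y)

-- Weighted SPT-order

-- a * d ≤ c * b says a / b ≤ c / d.
cross-≤-trans : ∀ a b c d e f → 0 < d → a * d ≤ c * b → c * f ≤ e * d → a * f ≤ e * b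
cross-≤-trans a b c d@(suc _) e f _ ad≤cb cf≤ed = *-cancelʳ-≤ (a * f) (e * b) d (begin
  a * f * d  ≡⟨ xy∙z≈xz∙y a f d ⟩
  a * d * f  ≤⟨ *-monoˡ-≤ f ad≤cb ⟩
  c * b * f  ≡⟨ xy∙z≈xz∙y c b f ⟩
  c * f * b  ≤⟨ *-monoˡ-≤ b cf≤ed ⟩
  e * d * b  ≡⟨ xy∙z≈xz∙y e d b ⟩
  e * b * d  ∎)
  where open ≤-Reasoning

reflects⇒T⇔ : ∀ {a} {A : Set a} {b} → Reflects A b → T b ⇔ A
reflects⇒T⇔ (ofʸ a) = mk⇔ (const a) (const tt)
reflects⇒T⇔ (ofⁿ ¬a) = mk⇔ (λ ()) ¬a

module RatioOrder {n : ℕ} (p w : Fin n → ℕ) where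

  -- p i / w i ≤ p k / w k, reading x / 0 as ∞.
  RatioLe : Fin n → Fin n → Set
  RatioLe i k = w k ≡ 0 ⊎ (0 < w i × p i * w k ≤ p k * w i)

  RatioLt : Fin n → Fin n → Set
  RatioLt i k = 0 < w i × (w k ≡ 0 ⊎ p i * w k < p k * w i)

  RatioEq : Fin n → Fin n → Set
  RatioEq i k = (w i ≡ 0 × w k ≡ 0) ⊎ (0 < w i × 0 < w k × p i * w k ≡ p k * w i)

  ratioLe? : ∀ i k → Dec (RatioLe i k)
  ratioLe? i k = (w k ≟ 0) ⊎-dec ((0 <? w i) ×-dec (p i * w k ≤? p k * w i))

  ratioLe-trans : ∀ {i k l} → RatioLe i k → RatioLe k l → RatioLe i l
  ratioLe-trans _ (inj₁ wl≡0) = inj₁ wl≡0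
  ratioLe-trans (inj₁ wk≡0) (inj₂ (wk>0 , _)) = contradiction wk≡0 (n>0⇒n≢0 wk>0)
  ratioLe-trans {i} {k} {l} (inj₂ (wi>0 , ik)) (inj₂ (wk>0 , kl)) =
    inj₂ (wi>0 , cross-≤-trans (p i) (w i) (p k) (w k) (p l) (w l) wk>0 ik kl)

  ratioLe-total : ∀ i k → RatioLe i k ⊎ RatioLe k i
  ratioLe-total i k with ratioLe? i k | w i ≟ 0
  ... | yes i≤k | _ = inj₁ i≤k
  ... | no _ | yes wi≡0 = inj₂ (inj₁ wi≡0)
  ... | no i≰k | no wi≢0 = inj₂ (inj₂ (n≢0⇒n>0 (i≰k ∘ inj₁) ,
                                       <⇒≤ (≰⇒> (i≰k ∘ inj₂ ∘ (n≢0⇒n>0 wi≢0 ,_)))))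

  ratioLt⇒ : ∀ {i k} → RatioLt i k → RatioLe i k × ¬ RatioLe k i
  ratioLt⇒ (wi>0 , inj₁ wk≡0) = inj₁ wk≡0 ,
    [ n>0⇒n≢0 wi>0 , (λ (wk>0 , _) → n>0⇒n≢0 wk>0 wk≡0) ]
  ratioLt⇒ (wi>0 , inj₂ ik) = inj₂ (wi>0 , <⇒≤ ik) ,
    [ n>0⇒n≢0 wi>0 , (λ (_ , ki) → <⇒≱ ik ki) ]

  ratioLt⇐ : ∀ {i k} → RatioLe i k → ¬ RatioLe k i → RatioLt i k
  ratioLt⇐ (inj₁ wk≡0) k≰i = n≢0⇒n>0 (k≰i ∘ inj₁) , inj₁ wk≡0
  ratioLt⇐ {i} {k} (inj₂ (wi>0 , ik)) k≰i with w k ≟ 0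
  ... | yes wk≡0 = wi>0 , inj₁ wk≡0
  ... | no wk≢0 = wi>0 , inj₂ (≤∧≢⇒< ik (k≰i ∘ inj₂ ∘ (n≢0⇒n>0 wk≢0 ,_) ∘ ≤-reflexive ∘ sym))

  ratioEq⇒ : ∀ {i k} → RatioEq i k → RatioLe i k × RatioLe k i
  ratioEq⇒ (inj₁ (wi≡0 , wk≡0)) = inj₁ wk≡0 , inj₁ wi≡0
  ratioEq⇒ (inj₂ (wi>0 , wk>0 , eq)) = inj₂ (wi>0 , ≤-reflexive eq) , inj₂ (wk>0 , ≤-reflexive (sym eq))

  ratioEq⇐ : ∀ {i k} → RatioLe i k → RatioLe k i → RatioEq i k
  ratioEq⇐ (inj₁ wk≡0) (inj₁ wi≡0) = inj₁ (wi≡0 , wk≡0)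
  ratioEq⇐ (inj₁ wk≡0) (inj₂ (wk>0 , _)) = contradiction wk≡0 (n>0⇒n≢0 wk>0)
  ratioEq⇐ (inj₂ (wi>0 , _)) (inj₁ wi≡0) = contradiction wi≡0 (n>0⇒n≢0 wi>0)
  ratioEq⇐ (inj₂ (wi>0 , ik)) (inj₂ (wk>0 , ki)) = inj₂ (wi>0 , wk>0 , ≤-antisym ik ki)

  -- Weighted SPT-order compares the total preorder RatioLe first and breaks ties by index.
  Lex : Fin n → Fin n → Set
  Lex i k = RatioLe i k × (RatioLe k i → toℕ i < toℕ k)

  Lex-irrefl : ∀ {i} → ¬ Lex i i
  Lex-irrefl (ii , ii⇒<) = <-irrefl refl (ii⇒< ii)

  Lex-trans : ∀ {i k l} → Lex i k → Lex k l → Lex i l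
  Lex-trans (ik , ki⇒<) (kl , lk⇒<) = ratioLe-trans ik kl ,
    λ li → <-trans (ki⇒< (ratioLe-trans kl li)) (lk⇒< (ratioLe-trans li ik))

  Lex-compare : ∀ i k → i ≢ k → Lex i k ⊎ Lex k i
  Lex-compare i k i≢k with ratioLe? i k | ratioLe? k i
  ... | yes ik | no k≰i = inj₁ (ik , ⊥-elim ∘ k≰i)
  ... | no i≰k | yes ki = inj₂ (ki , ⊥-elim ∘ i≰k)
  ... | no i≰k | no k≰i = ⊥-elim ([ i≰k , k≰i ] (ratioLe-total i k))
  ... | yes ik | yes ki with <-cmp (toℕ i) (toℕ k)
  ...   | tri< i<k _ _ = inj₁ (ik , const i<k)
  ...   | tri≈ _ i≡k _ = contradiction (toℕ-injective i≡k) i≢k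
  ...   | tri> _ _ k<i = inj₂ (ki , const k<i)

-- Sorted lists

module _ {a ℓ} {A : Set a} {_⊏_ : Rel A ℓ} (⊏-asym : Asymmetric _⊏_) where

  private
    ⊏-irrefl : ∀ {x} → ¬ x ⊏ x
    ⊏-irrefl x⊏x = ⊏-asym x⊏x x⊏x

  sorted-unique : ∀ {xs ys} → AllPairs _⊏_ xs → AllPairs _⊏_ ys →
                  (∀ z → z ∈ xs ⇔ z ∈ ys) → xs ≡ ys
  sorted-unique [] [] _ = refl
  sorted-unique [] (_∷_ {y} _ _) xs⇔ys with Equivalence.from (xs⇔ys y) (here refl)
  ... | ()
  sorted-unique (_∷_ {x} _ _) [] xs⇔ys with Equivalence.to (xs⇔ys x) (here refl)
  ... | ()
  sorted-unique (_∷_ {x} {xs} x⊏xs sxs) (_∷_ {y} {ys} y⊏ys sys) xs⇔ys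
    with heads-≡ (Equivalence.to (xs⇔ys x) (here refl)) (Equivalence.from (xs⇔ys y) (here refl))
    where
      heads-≡ : x ∈ y ∷ ys → y ∈ x ∷ xs → x ≡ y
      heads-≡ (here x≡y) _ = x≡y
      heads-≡ (there _) (here y≡x) = sym y≡x
      heads-≡ (there x∈ys) (there y∈xs) = ⊥-elim (⊏-asym (All.lookup x⊏xs y∈xs) (All.lookup y⊏ys x∈ys))
  ... | refl = cong (x ∷_) (sorted-unique sxs sys λ z → mk⇔
        (λ z∈xs → drop-head x⊏xs z∈xs (Equivalence.to (xs⇔ys z) (there z∈xs)))
        (λ z∈ys → drop-head y⊏ys z∈ys (Equivalence.from (xs⇔ys z) (there z∈ys))))
    where
      drop-head : ∀ {zs ws z} → All (x ⊏_) zs → z ∈ zs → z ∈ x ∷ ws → z ∈ ws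
      drop-head x⊏zs z∈zs (here refl) = ⊥-elim (⊏-irrefl (All.lookup x⊏zs z∈zs))
      drop-head _ _ (there z∈ws) = z∈ws

  sorted-before : ∀ l₁ {k l₂ i} → AllPairs _⊏_ (l₁ ++ k ∷ l₂) → i ∈ l₁ ++ k ∷ l₂ → i ⊏ k → i ∈ l₁
  sorted-before [] _ (here refl) i⊏k = ⊥-elim (⊏-irrefl i⊏k)
  sorted-before [] (k⊏l₂ ∷ _) (there i∈l₂) i⊏k = ⊥-elim (⊏-asym i⊏k (All.lookup k⊏l₂ i∈l₂))
  sorted-before (_ ∷ _) _ (here i≡x) _ = here i≡x
  sorted-before (_ ∷ l₁) (_ ∷ s) (there i∈) i⊏k = there (sorted-before l₁ s i∈ i⊏k)

sorted-++ : ∀ {a ℓ} {A : Set a} {_⊏_ : Rel A ℓ} xs {ys x y} →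
            AllPairs _⊏_ (xs ++ ys) → x ∈ xs → y ∈ ys → x ⊏ y
sorted-++ (_ ∷ xs) (x⊏xs ∷ _) (here refl) y∈ys = All.lookup x⊏xs (∈-++⁺ʳ xs y∈ys)
sorted-++ (_ ∷ xs) (_ ∷ s) (there x∈xs) y∈ys = sorted-++ xs s x∈xs y∈ys

Unique-++-∷⁻ : ∀ {a} {A : Set a} xs {x : A} {ys} → Unique (xs ++ x ∷ ys) → x ∉ xs × x ∉ ys
Unique-++-∷⁻ [] (x∉ys ∷ _) = (λ ()) , λ x∈ys → All.lookup x∉ys x∈ys refl
Unique-++-∷⁻ (z ∷ xs) {x} (z∉ ∷ u) with Unique-++-∷⁻ xs u
... | x∉xs , x∉ys = x∉z∷xs , x∉ys
  where
    x∉z∷xs : x ∉ z ∷ xs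
    x∉z∷xs (here x≡z) = All.lookup z∉ (∈-++⁺ʳ xs (here refl)) (sym x≡z)
    x∉z∷xs (there x∈xs) = x∉xs x∈xs

module Scheduling {n K : ℕ} (p w : Fin n → ℕ) (req : Fin n → Fin K → Bool) where

  open Sched p w req
  open RatioOrder p w
  open import Data.List.Membership.DecPropositional (F._≟_ {n}) using (_∈?_)
  open import Data.List.Relation.Binary.Permutation.Setoid.Properties (setoid (Op n K)) using (Unique-resp-↭)

  _≺_ : Fin n → Fin n → Set
  _≺_ = SptBefore

  Sorted : List (Fin n) → Set
  Sorted = AllPairs _≺_

  ≺⇔ratio : ∀ {i k} → i ≺ k ⇔ (RatioLt i k ⊎ (RatioEq i k × toℕ i < toℕ k))
  ≺⇔ratio {i} {k} = reflects⇒T⇔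
    ((<ᵇ-reflects-< 0 (w i) ×-reflects (≡ᵇ-reflects-≡ (w k) 0 ⊎-reflects <ᵇ-reflects-< _ _))
     ⊎-reflects (((≡ᵇ-reflects-≡ (w i) 0 ×-reflects ≡ᵇ-reflects-≡ (w k) 0)
                  ⊎-reflects (<ᵇ-reflects-< 0 (w i) ×-reflects
                              (<ᵇ-reflects-< 0 (w k) ×-reflects ≡ᵇ-reflects-≡ _ _)))
                 ×-reflects <ᵇ-reflects-< _ _))
    where
      ≡ᵇ-reflects-≡ : ∀ m n → Reflects (m ≡ n) (m ≡ᵇ n)
      ≡ᵇ-reflects-≡ m n = fromEquivalence (≡ᵇ⇒≡ m n) (≡⇒≡ᵇ m n)

  ≺⇒Lex : ∀ {i k} → i ≺ k → Lex i k
  ≺⇒Lex i≺k with Equivalence.to ≺⇔ratio i≺k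
  ... | inj₁ lt = let ik , k≰i = ratioLt⇒ lt in ik , ⊥-elim ∘ k≰i
  ... | inj₂ (eq , i<k) = proj₁ (ratioEq⇒ eq) , const i<k

  Lex⇒≺ : ∀ {i k} → Lex i k → i ≺ k
  Lex⇒≺ {i} {k} (ik , ki⇒<) = Equivalence.from ≺⇔ratio (by-cases (ratioLe? k i))
    where
      by-cases : Dec (RatioLe k i) → RatioLt i k ⊎ (RatioEq i k × toℕ i < toℕ k)
      by-cases (yes ki) = inj₂ (ratioEq⇐ ik ki , ki⇒< ki)
      by-cases (no k≰i) = inj₁ (ratioLt⇐ ik k≰i)

  ≺-trans : ∀ {i k l} → i ≺ k → k ≺ l → i ≺ l
  ≺-trans i≺k k≺l = Lex⇒≺ (Lex-trans (≺⇒Lex i≺k) (≺⇒Lex k≺l))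

  ≺-asym : ∀ {i k} → i ≺ k → ¬ k ≺ i
  ≺-asym i≺k k≺i = Lex-irrefl (≺⇒Lex (≺-trans i≺k k≺i))

  ≺-compare : ∀ i k → i ≢ k → i ≺ k ⊎ k ≺ i
  ≺-compare i k i≢k = Sum.map Lex⇒≺ Lex⇒≺ (Lex-compare i k i≢k)

  ∈-insertSpt⁻ : ∀ j L {y} → y ∈ insertSpt j L → y ≡ j ⊎ y ∈ L
  ∈-insertSpt⁻ j [] (here y≡j) = inj₁ y≡j
  ∈-insertSpt⁻ j (x ∷ L) y∈ with sptBeforeᵇ j x | y∈
  ... | true  | here y≡j = inj₁ y≡j
  ... | true  | there y∈xL = inj₂ y∈xL
  ... | false | here y≡x = inj₂ (here y≡x)
  ... | false | there y∈ = Sum.map₂ there (∈-insertSpt⁻ j L y∈)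

  ∈-insertSpt⁺ˡ : ∀ j L → j ∈ insertSpt j L
  ∈-insertSpt⁺ˡ j [] = here refl
  ∈-insertSpt⁺ˡ j (x ∷ L) with sptBeforeᵇ j x
  ... | true = here refl
  ... | false = there (∈-insertSpt⁺ˡ j L)

  ∈-insertSpt⁺ʳ : ∀ j L {y} → y ∈ L → y ∈ insertSpt j L
  ∈-insertSpt⁺ʳ j (x ∷ L) y∈ with sptBeforeᵇ j x | y∈
  ... | true  | _ = there y∈
  ... | false | here y≡x = here y≡x
  ... | false | there y∈L = there (∈-insertSpt⁺ʳ j L y∈L)

  insertSpt-sorted : ∀ j {L} → Sorted L → j ∉ L → Sorted (insertSpt j L)
  insertSpt-sorted j [] _ = [] ∷ []
  insertSpt-sorted j {x ∷ L} (x≺L ∷ sL) j∉ with sptBeforeᵇ j x in j≺?x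
  ... | true = (j≺x ∷ All.map (≺-trans j≺x) x≺L) ∷ x≺L ∷ sL
    where
      j≺x : j ≺ x
      j≺x = subst T (sym j≺?x) tt
  ... | false = All.tabulate x≺ ∷ insertSpt-sorted j sL (j∉ ∘ there)
    where
      x≺j : x ≺ j
      x≺j = [ (λ j≺x → ⊥-elim (subst T j≺?x j≺x)) , id ] (≺-compare j x (j∉ ∘ here))
      x≺ : ∀ {y} → y ∈ insertSpt j L → x ≺ y
      x≺ y∈ = [ (λ { refl → x≺j }) , All.lookup x≺L ] (∈-insertSpt⁻ j L y∈)

  ∈-foldr-insertSpt⁻ : ∀ l {y} → y ∈ foldr insertSpt [] l → y ∈ l
  ∈-foldr-insertSpt⁻ (x ∷ l) y∈ with ∈-insertSpt⁻ x (foldr insertSpt [] l) y∈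
  ... | inj₁ y≡x = here y≡x
  ... | inj₂ y∈′ = there (∈-foldr-insertSpt⁻ l y∈′)

  ∈-foldr-insertSpt⁺ : ∀ l {y} → y ∈ l → y ∈ foldr insertSpt [] l
  ∈-foldr-insertSpt⁺ (x ∷ l) (here refl) = ∈-insertSpt⁺ˡ x (foldr insertSpt [] l)
  ∈-foldr-insertSpt⁺ (x ∷ l) (there y∈) =
    ∈-insertSpt⁺ʳ x (foldr insertSpt [] l) (∈-foldr-insertSpt⁺ l y∈)

  foldr-insertSpt-sorted : ∀ {l} → Unique l → Sorted (foldr insertSpt [] l)
  foldr-insertSpt-sorted [] = []
  foldr-insertSpt-sorted {x ∷ l} (x∉l ∷ ul) = insertSpt-sorted x (foldr-insertSpt-sorted ul)
    (λ x∈ → All.lookup x∉l (∈-foldr-insertSpt⁻ l x∈) refl)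

  sptOrder-sorted : Sorted sptOrder
  sptOrder-sorted = foldr-insertSpt-sorted (allFin⁺ n)

  ∈-sptOrder : ∀ y → y ∈ sptOrder
  ∈-sptOrder y = ∈-foldr-insertSpt⁺ (allFin n) (∈-allFin y)

  take-sptOrder-≺ : ∀ k {y z} → y ∈ take k sptOrder → z ∉ take k sptOrder → y ≺ z
  take-sptOrder-≺ k {z = z} y∈ z∉ = sorted-++ (take k sptOrder) sorted-split y∈ z∈drop
    where
      split : take k sptOrder ++ drop k sptOrder ≡ sptOrder
      split = take++drop≡id k sptOrder
      sorted-split : Sorted (take k sptOrder ++ drop k sptOrder)
      sorted-split = subst Sorted (sym split) sptOrder-sorted
      z∈drop : z ∈ drop k sptOrder
      z∈drop with ∈-++⁻ (take k sptOrder) (subst (z ∈_) (sym split) (∈-sptOrder z))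
      ... | inj₁ z∈take = contradiction z∈take z∉
      ... | inj₂ z∈drop = z∈drop

  -- Schedules as blocks of jobs between setup operations

  setups-++ : ∀ xs {ys} → setups (xs ++ ys) ≡ setups xs ++ setups ys
  setups-++ [] = refl
  setups-++ (inj₁ _ ∷ xs) = setups-++ xs
  setups-++ (inj₂ f ∷ xs) = cong (f ∷_) (setups-++ xs)

  setups-jobs : ∀ L → setups (map inj₁ L) ≡ []
  setups-jobs [] = refl
  setups-jobs (_ ∷ L) = setups-jobs L

  ∈-setups⁺ : ∀ σ {f} → inj₂ f ∈ σ → f ∈ setups σ
  ∈-setups⁺ (inj₁ _ ∷ σ) (there f∈) = ∈-setups⁺ σ f∈
  ∈-setups⁺ (inj₂ _ ∷ σ) (here refl) = here refl
  ∈-setups⁺ (inj₂ _ ∷ σ) (there f∈) = there (∈-setups⁺ σ f∈)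

  ∈-setups⁻ : ∀ σ {f} → f ∈ setups σ → inj₂ f ∈ σ
  ∈-setups⁻ (inj₁ _ ∷ σ) f∈ = there (∈-setups⁻ σ f∈)
  ∈-setups⁻ (inj₂ _ ∷ σ) (here refl) = here refl
  ∈-setups⁻ (inj₂ _ ∷ σ) (there f∈) = there (∈-setups⁻ σ f∈)

  ∈-map-inj₁⁻ : ∀ {L : List (Fin n)} {i} → inj₁ {B = Fin K} i ∈ map inj₁ L → i ∈ L
  ∈-map-inj₁⁻ i∈ with ∈-map⁻ inj₁ i∈
  ... | _ , x∈L , refl = x∈L

  MissingSetup : Fin n → List (Fin K) → Set
  MissingSetup i fs = ∃ λ f → T (req i f) × f ∉ fs

  cannotBeScheduledAfter⇔ : ∀ {i} xs → CannotBeScheduledAfter i xs ⇔ MissingSetup i (setups xs)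
  cannotBeScheduledAfter⇔ xs = mk⇔ (λ (f , r , f∉) → f , r , f∉ ∘ ∈-setups⁻ xs)
                                   (λ (f , r , f∉) → f , r , f∉ ∘ ∈-setups⁺ xs)

  Blocks : Set
  Blocks = ℕ → List (Fin n)

  assemble : Blocks → List (Fin K) → Schedule n K
  laterBlocks : Blocks → List (Fin K) → Schedule n K
  assemble B τ = map inj₁ (B 0) ++ laterBlocks B τ
  laterBlocks B [] = []
  laterBlocks B (f ∷ τ) = inj₂ f ∷ assemble (B ∘ suc) τ

  assemble-cong : ∀ τ {B B′} → (∀ b → B b ≡ B′ b) → assemble B τ ≡ assemble B′ τ
  assemble-cong [] B≗B′ = cong (λ L → map inj₁ L ++ []) (B≗B′ 0)
  assemble-cong (f ∷ τ) B≗B′ =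
    cong₂ (λ L σ → map inj₁ L ++ inj₂ f ∷ σ) (B≗B′ 0) (assemble-cong τ (B≗B′ ∘ suc))

  -- The part of assemble B τ before block b (for b ≤ length τ).
  blocksBefore : Blocks → List (Fin K) → ℕ → Schedule n K
  blocksBefore B τ zero = []
  blocksBefore B [] (suc b) = []
  blocksBefore B (f ∷ τ) (suc b) = map inj₁ (B 0) ++ inj₂ f ∷ blocksBefore (B ∘ suc) τ b

  setups-blocksBefore : ∀ B τ {b} → b ≤ length τ → setups (blocksBefore B τ b) ≡ take b τ
  setups-blocksBefore B τ {zero} _ = refl
  setups-blocksBefore B (f ∷ τ) {suc b} (s≤s b≤) = begin
    setups (map inj₁ (B 0) ++ inj₂ f ∷ blocksBefore (B ∘ suc) τ b)
      ≡⟨ setups-++ (map inj₁ (B 0)) ⟩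
    setups (map inj₁ (B 0)) ++ f ∷ setups (blocksBefore (B ∘ suc) τ b)
      ≡⟨ cong₂ (λ fs gs → fs ++ f ∷ gs) (setups-jobs (B 0)) (setups-blocksBefore (B ∘ suc) τ b≤) ⟩
    f ∷ take b τ ∎
    where open ≡-Reasoning

  ∈-blocksBefore⁺ : ∀ B τ {b c i} → b ≤ length τ → c < b → i ∈ B c → inj₁ i ∈ blocksBefore B τ b
  ∈-blocksBefore⁺ B (f ∷ τ) {suc b} {zero} _ _ i∈ = ∈-++⁺ˡ (∈-map⁺ inj₁ i∈)
  ∈-blocksBefore⁺ B (f ∷ τ) {suc b} {suc c} (s≤s b≤) (s≤s c<b) i∈ =
    ∈-++⁺ʳ (map inj₁ (B 0)) (there (∈-blocksBefore⁺ (B ∘ suc) τ b≤ c<b i∈))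

  ∈-blocksBefore⁻ : ∀ B τ b {i} → inj₁ i ∈ blocksBefore B τ b → ∃ λ c → c < b × i ∈ B c
  ∈-blocksBefore⁻ B (f ∷ τ) (suc b) i∈ with ∈-++⁻ (map inj₁ (B 0)) i∈
  ... | inj₁ i∈B₀ = 0 , s≤s z≤n , ∈-map-inj₁⁻ i∈B₀
  ... | inj₂ (there i∈′) = let c , c<b , i∈Bc = ∈-blocksBefore⁻ (B ∘ suc) τ b i∈′ in
                           suc c , s≤s c<b , i∈Bc

  map-inj₁-++-∷⁻ : ∀ L {r xs ys : Schedule n K} {k} → map inj₁ L ++ r ≡ xs ++ inj₁ k ∷ ys →
    (∃₂ λ l₁ l₂ → L ≡ l₁ ++ k ∷ l₂ × xs ≡ map inj₁ l₁) ⊎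
    (∃ λ xs′ → xs ≡ map inj₁ L ++ xs′ × r ≡ xs′ ++ inj₁ k ∷ ys)
  map-inj₁-++-∷⁻ [] {xs = xs} e = inj₂ (xs , refl , e)
  map-inj₁-++-∷⁻ (x ∷ L) {xs = []} refl = inj₁ ([] , L , refl , refl)
  map-inj₁-++-∷⁻ (x ∷ L) {xs = o ∷ xs} e with ∷-injective e
  ... | refl , e′ with map-inj₁-++-∷⁻ L e′
  ...   | inj₁ (l₁ , l₂ , L≡ , refl) = inj₁ (x ∷ l₁ , l₂ , cong (x ∷_) L≡ , refl)
  ...   | inj₂ (xs′ , refl , r≡) = inj₂ (xs′ , refl , r≡)

  record BlockPosition (B : Blocks) (τ : List (Fin K)) (xs : Schedule n K) (k : Fin n) : Set where
    field
      block : ℕ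
      block≤ : block ≤ length τ
      before after : List (Fin n)
      block≡ : B block ≡ before ++ k ∷ after
      prefix≡ : xs ≡ blocksBefore B τ block ++ map inj₁ before

  assemble-position : ∀ B τ {xs k ys} → assemble B τ ≡ xs ++ inj₁ k ∷ ys → BlockPosition B τ xs k
  assemble-position B τ e with map-inj₁-++-∷⁻ (B 0) {r = laterBlocks B τ} e
  ... | inj₁ (l₁ , l₂ , B₀≡ , refl) =
    record { block = 0 ; block≤ = z≤n ; before = l₁ ; after = l₂ ; block≡ = B₀≡ ; prefix≡ = refl }
  assemble-position B [] e | inj₂ ([] , _ , ())
  assemble-position B [] e | inj₂ (_ ∷ _ , _ , ())
  assemble-position B (f ∷ τ) e | inj₂ ([] , _ , ())
  assemble-position B (f ∷ τ) e | inj₂ (_ ∷ xs′ , refl , r≡) with ∷-injective r≡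
  ... | refl , e′ = record
    { block = suc block ; block≤ = s≤s block≤ ; before = before ; after = after ; block≡ = block≡
    ; prefix≡ = trans (cong (λ σ → map inj₁ (B 0) ++ inj₂ f ∷ σ) prefix≡)
                      (sym (++-assoc (map inj₁ (B 0)) (inj₂ f ∷ _) (map inj₁ before))) }
    where open BlockPosition (assemble-position (B ∘ suc) τ e′)

  -- Moves

  withoutJob : Fin n → List (Fin n) → List (Fin n)
  withoutJob j = filter (¬? ∘ (j F.≟_))

  ∈-withoutJob⁻ : ∀ j {L y} → y ∈ withoutJob j L → y ∈ L × y ≢ j
  ∈-withoutJob⁻ j y∈ = let y∈L , j≢y = ∈-filter⁻ (¬? ∘ (j F.≟_)) y∈ in y∈L , j≢y ∘ sym

  ∈-withoutJob⁺ : ∀ j {L y} → y ∈ L → y ≢ j → y ∈ withoutJob j L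
  ∈-withoutJob⁺ j y∈L y≢j = ∈-filter⁺ (¬? ∘ (j F.≟_)) y∈L (y≢j ∘ sym)

  removeJob-++ : ∀ j xs {ys} → removeJob j (xs ++ ys) ≡ removeJob j xs ++ removeJob j ys
  removeJob-++ j [] = refl
  removeJob-++ j (inj₁ x ∷ xs) with j F.≟ x
  ... | yes _ = removeJob-++ j xs
  ... | no _ = cong (inj₁ x ∷_) (removeJob-++ j xs)
  removeJob-++ j (inj₂ f ∷ xs) = cong (inj₂ f ∷_) (removeJob-++ j xs)

  removeJob-jobs : ∀ j L → removeJob j (map inj₁ L) ≡ map inj₁ (withoutJob j L)
  removeJob-jobs j [] = refl
  removeJob-jobs j (x ∷ L) with j F.≟ x
  ... | yes _ = removeJob-jobs j L
  ... | no _ = cong (inj₁ x ∷_) (removeJob-jobs j L)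

  removeJob-assemble : ∀ j B τ → removeJob j (assemble B τ) ≡ assemble (withoutJob j ∘ B) τ
  removeJob-assemble j B [] =
    trans (removeJob-++ j (map inj₁ (B 0))) (cong (_++ []) (removeJob-jobs j (B 0)))
  removeJob-assemble j B (f ∷ τ) = trans (removeJob-++ j (map inj₁ (B 0)))
    (cong₂ (λ σ ρ → σ ++ inj₂ f ∷ ρ) (removeJob-jobs j (B 0)) (removeJob-assemble j (B ∘ suc) τ))

  -- The premise says that r is empty or starts with a setup operation.
  insertInBlock-head : ∀ j L {r} → insertInBlock j 0 r ≡ inj₁ j ∷ r →
                       insertInBlock j 0 (map inj₁ L ++ r) ≡ map inj₁ (insertSpt j L) ++ r
  insertInBlock-head j [] r-starts = r-starts
  insertInBlock-head j (x ∷ L) r-starts with sptBeforeᵇ j x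
  ... | true = refl
  ... | false = cong (inj₁ x ∷_) (insertInBlock-head j L r-starts)

  insertInBlock-skip : ∀ j b L f r →
    insertInBlock j (suc b) (map inj₁ L ++ inj₂ f ∷ r) ≡ map inj₁ L ++ inj₂ f ∷ insertInBlock j b r
  insertInBlock-skip j b [] f r = refl
  insertInBlock-skip j b (x ∷ L) f r = cong (inj₁ x ∷_) (insertInBlock-skip j b L f r)

  updateBlock : ℕ → (List (Fin n) → List (Fin n)) → Blocks → Blocks
  updateBlock b h B c = if c ≡ᵇ b then h (B c) else B c

  updateBlock-same : ∀ b h B → updateBlock b h B b ≡ h (B b)
  updateBlock-same b h B with b ≡ᵇ b | ≡⇒≡ᵇ b b refl
  ... | true | _ = refl

  updateBlock-other : ∀ {b c} h B → c ≢ b → updateBlock b h B c ≡ B c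
  updateBlock-other {b} {c} h B c≢b with c ≡ᵇ b | ≡ᵇ⇒≡ c b
  ... | false | _ = refl
  ... | true | c≡b = contradiction (c≡b tt) c≢b

  insertInBlock-assemble : ∀ j B τ {b} → b ≤ length τ →
    insertInBlock j b (assemble B τ) ≡ assemble (updateBlock b (insertSpt j) B) τ
  insertInBlock-assemble j B [] z≤n = insertInBlock-head j (B 0) refl
  insertInBlock-assemble j B (f ∷ τ) z≤n = insertInBlock-head j (B 0) refl
  insertInBlock-assemble j B (f ∷ τ) {suc b} (s≤s b≤) =
    trans (insertInBlock-skip j b (B 0) f (assemble (B ∘ suc) τ))
          (cong (λ σ → map inj₁ (B 0) ++ inj₂ f ∷ σ) (insertInBlock-assemble j (B ∘ suc) τ b≤))

  sptBlock : (Fin n → ℕ) → Blocks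
  sptBlock g b = filter (λ y → g y ≟ b) sptOrder

  ∈-sptBlock⁺ : ∀ g {b y} → g y ≡ b → y ∈ sptBlock g b
  ∈-sptBlock⁺ g {b} {y} gy≡b = ∈-filter⁺ (λ y → g y ≟ b) (∈-sptOrder y) gy≡b

  ∈-sptBlock⁻ : ∀ g {b y} → y ∈ sptBlock g b → g y ≡ b
  ∈-sptBlock⁻ g {b} y∈ = proj₂ (∈-filter⁻ (λ y → g y ≟ b) {xs = sptOrder} y∈)

  sptBlock-sorted : ∀ g b → Sorted (sptBlock g b)
  sptBlock-sorted g b = AllPairs.filter⁺ (λ y → g y ≟ b) sptOrder-sorted

  arrange : List (Fin K) → (Fin n → ℕ) → Schedule n K
  arrange τ g = assemble (sptBlock g) τ

  arrange-cong : ∀ τ {g g′} → (∀ y → g y ≡ g′ y) → arrange τ g ≡ arrange τ g′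
  arrange-cong τ {g} {g′} g≗g′ = assemble-cong τ λ b →
    filter-≐ (λ y → g y ≟ b) (λ y → g′ y ≟ b)
             ((λ {y} → trans (sym (g≗g′ y))) , (λ {y} → trans (g≗g′ y))) sptOrder

  _[_↦_] : (Fin n → ℕ) → Fin n → ℕ → Fin n → ℕ
  (g [ j ↦ b ]) y = if does (y F.≟ j) then b else g y

  ↦-same : ∀ g j b → (g [ j ↦ b ]) j ≡ b
  ↦-same g j b with j F.≟ j
  ... | yes _ = refl
  ... | no j≢j = contradiction refl j≢j

  ↦-other : ∀ g {j y} b → y ≢ j → (g [ j ↦ b ]) y ≡ g y
  ↦-other g {j} {y} b y≢j with y F.≟ j
  ... | yes y≡j = contradiction y≡j y≢j
  ... | no _ = refl

  ∈-sptBlock-↦ : ∀ g {j y} b {c} → y ≢ j → y ∈ sptBlock g c ⇔ y ∈ sptBlock (g [ j ↦ b ]) c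
  ∈-sptBlock-↦ g b y≢j = mk⇔
    (λ y∈ → ∈-sptBlock⁺ (g [ _ ↦ b ]) (trans (↦-other g b y≢j) (∈-sptBlock⁻ g y∈)))
    (λ y∈ → ∈-sptBlock⁺ g (trans (sym (↦-other g b y≢j)) (∈-sptBlock⁻ (g [ _ ↦ b ]) y∈)))

  insertSpt-sptBlock : ∀ j b g → insertSpt j (withoutJob j (sptBlock g b)) ≡ sptBlock (g [ j ↦ b ]) b
  insertSpt-sptBlock j b g =
    sorted-unique ≺-asym sorted (sptBlock-sorted (g [ j ↦ b ]) b) λ _ → mk⇔ to from
    where
      L : List (Fin n)
      L = withoutJob j (sptBlock g b)
      sorted : Sorted (insertSpt j L)
      sorted = insertSpt-sorted j (AllPairs.filter⁺ (¬? ∘ (j F.≟_)) (sptBlock-sorted g b))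
                                  (λ j∈ → proj₂ (∈-withoutJob⁻ j {sptBlock g b} j∈) refl)
      to : ∀ {y} → y ∈ insertSpt j L → y ∈ sptBlock (g [ j ↦ b ]) b
      to y∈ with ∈-insertSpt⁻ j L y∈
      ... | inj₁ refl = ∈-sptBlock⁺ (g [ j ↦ b ]) (↦-same g j b)
      ... | inj₂ y∈L = let y∈gb , y≢j = ∈-withoutJob⁻ j y∈L in
                        Equivalence.to (∈-sptBlock-↦ g b y≢j) y∈gb
      from : ∀ {y} → y ∈ sptBlock (g [ j ↦ b ]) b → y ∈ insertSpt j L
      from {y} y∈ with y F.≟ j
      ... | yes refl = ∈-insertSpt⁺ˡ j L
      ... | no y≢j =
        ∈-insertSpt⁺ʳ j L (∈-withoutJob⁺ j (Equivalence.from (∈-sptBlock-↦ g b y≢j) y∈) y≢j)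

  withoutJob-sptBlock : ∀ j b g {c} → c ≢ b → withoutJob j (sptBlock g c) ≡ sptBlock (g [ j ↦ b ]) c
  withoutJob-sptBlock j b g {c} c≢b = sorted-unique ≺-asym
    (AllPairs.filter⁺ (¬? ∘ (j F.≟_)) (sptBlock-sorted g c)) (sptBlock-sorted (g [ j ↦ b ]) c)
    λ _ → mk⇔ to from
    where
      to : ∀ {y} → y ∈ withoutJob j (sptBlock g c) → y ∈ sptBlock (g [ j ↦ b ]) c
      to y∈ = let y∈gc , y≢j = ∈-withoutJob⁻ j y∈ in Equivalence.to (∈-sptBlock-↦ g b y≢j) y∈gc
      from : ∀ {y} → y ∈ sptBlock (g [ j ↦ b ]) c → y ∈ withoutJob j (sptBlock g c)
      from {y} y∈ with y F.≟ j
      ... | yes refl = contradiction (trans (sym (∈-sptBlock⁻ (g [ j ↦ b ]) y∈)) (↦-same g j b)) c≢b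
      ... | no y≢j = ∈-withoutJob⁺ j (Equivalence.from (∈-sptBlock-↦ g b y≢j) y∈) y≢j

  moved-sptBlock : ∀ j b g c →
    updateBlock b (insertSpt j) (withoutJob j ∘ sptBlock g) c ≡ sptBlock (g [ j ↦ b ]) c
  moved-sptBlock j b g c with c ≟ b
  ... | yes refl = trans (updateBlock-same c (insertSpt j) (withoutJob j ∘ sptBlock g))
                         (insertSpt-sptBlock j c g)
  ... | no c≢b = trans (updateBlock-other (insertSpt j) (withoutJob j ∘ sptBlock g) c≢b)
                       (withoutJob-sptBlock j b g c≢b)

  move-arrange : ∀ j b τ g → toℕ b ≤ length τ → move j b (arrange τ g) ≡ arrange τ (g [ j ↦ toℕ b ])
  move-arrange j b τ g b≤ = begin
    insertInBlock j (toℕ b) (removeJob j (arrange τ g))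
      ≡⟨ cong (insertInBlock j (toℕ b)) (removeJob-assemble j (sptBlock g) τ) ⟩
    insertInBlock j (toℕ b) (assemble (withoutJob j ∘ sptBlock g) τ)
      ≡⟨ insertInBlock-assemble j _ τ b≤ ⟩
    assemble (updateBlock (toℕ b) (insertSpt j) (withoutJob j ∘ sptBlock g)) τ
      ≡⟨ assemble-cong τ (moved-sptBlock j (toℕ b) g) ⟩
    arrange τ (g [ j ↦ toℕ b ]) ∎
    where open ≡-Reasoning

  overrideOn : List (Fin n) → (Fin n → ℕ) → (Fin n → ℕ) → Fin n → ℕ
  overrideOn js h g y = if does (y ∈? js) then h y else g y

  overrideOn-∷ : ∀ j js h g y → overrideOn (j ∷ js) h g y ≡ overrideOn js h (g [ j ↦ h j ]) y
  overrideOn-∷ j js h g y with y F.≟ j | y ∈? js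
  ... | yes _ | yes _ = refl
  ... | yes refl | no _ = refl
  ... | no _ | yes _ = refl
  ... | no _ | no _ = refl

  overrideOn-∈ : ∀ {js} h g {y} → y ∈ js → overrideOn js h g y ≡ h y
  overrideOn-∈ {js} h g {y} y∈ with y ∈? js
  ... | yes _ = refl
  ... | no y∉ = contradiction y∈ y∉

  overrideOn-∉ : ∀ {js} h g {y} → y ∉ js → overrideOn js h g y ≡ g y
  overrideOn-∉ {js} h g {y} y∉ with y ∈? js
  ... | yes y∈ = contradiction y∈ y∉
  ... | no _ = refl

  applyMoves-arrange : ∀ β js τ g → (∀ j → toℕ (β j) ≤ length τ) →
    applyMoves β js (arrange τ g) ≡ arrange τ (overrideOn js (toℕ ∘ β) g)
  applyMoves-arrange β [] τ g _ = refl
  applyMoves-arrange β (j ∷ js) τ g β≤ = begin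
    applyMoves β js (move j (β j) (arrange τ g))
      ≡⟨ cong (applyMoves β js) (move-arrange j (β j) τ g (β≤ j)) ⟩
    applyMoves β js (arrange τ (g [ j ↦ toℕ (β j) ]))
      ≡⟨ applyMoves-arrange β js τ _ β≤ ⟩
    arrange τ (overrideOn js (toℕ ∘ β) (g [ j ↦ toℕ (β j) ]))
      ≡⟨ arrange-cong τ (sym ∘ overrideOn-∷ j js (toℕ ∘ β) g) ⟩
    arrange τ (overrideOn (j ∷ js) (toℕ ∘ β) g) ∎
    where open ≡-Reasoning

  assemble-lastBlock : ∀ B τ → (∀ c → c < length τ → B c ≡ []) →
                       assemble B τ ≡ map inj₂ τ ++ map inj₁ (B (length τ))
  assemble-lastBlock B [] _ = ++-identityʳ (map inj₁ (B 0))
  assemble-lastBlock B (f ∷ τ) empty = cong₂ (λ L σ → map inj₁ L ++ inj₂ f ∷ σ)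
    (empty 0 (s≤s z≤n)) (assemble-lastBlock (B ∘ suc) τ (λ c c< → empty (suc c) (s≤s c<)))

  πinit-arrange : ∀ τ → πinit τ ≡ arrange τ (const (length τ))
  πinit-arrange τ = sym (begin
    arrange τ (const (length τ))
      ≡⟨ assemble-lastBlock _ τ (λ c c< →
           filter-none (λ _ → length τ ≟ c) {xs = sptOrder} (All.tabulate λ _ → >⇒≢ c<)) ⟩
    map inj₂ τ ++ map inj₁ (sptBlock (const (length τ)) (length τ))
      ≡⟨ cong (λ L → map inj₂ τ ++ map inj₁ L)
              (filter-all (λ _ → length τ ≟ length τ) (All.tabulate λ _ → refl)) ⟩
    πinit τ ∎)
    where open ≡-Reasoning

  -- Feasibility and generalized weighted SPT-order of arranged schedules

  record ArrangedPrefix (τ : List (Fin K)) (g : Fin n → ℕ) (xs : Schedule n K) (k : Fin n) : Set where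
    field
      setups-prefix : setups xs ≡ take (g k) τ
      ≺-in-prefix : ∀ {i} → i ≺ k → g i ≤ g k → inj₁ i ∈ xs
      block-≤ : ∀ {i} → inj₁ i ∈ xs → g i ≤ g k

  arrange-prefix : ∀ τ g {xs k ys} → arrange τ g ≡ xs ++ inj₁ k ∷ ys → ArrangedPrefix τ g xs k
  arrange-prefix τ g {xs} {k} e = record
    { setups-prefix = begin
        setups xs                                           ≡⟨ cong setups prefix≡ ⟩
        setups (blocksBefore B τ block ++ map inj₁ before)  ≡⟨ setups-++ (blocksBefore B τ block) ⟩
        setups (blocksBefore B τ block) ++ setups (map inj₁ before)
          ≡⟨ cong₂ _++_ (setups-blocksBefore B τ block≤) (setups-jobs before) ⟩
        take block τ ++ []                                  ≡⟨ ++-identityʳ (take block τ) ⟩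
        take block τ                                        ≡⟨ cong (λ b → take b τ) (sym gk≡block) ⟩
        take (g k) τ                                        ∎
    ; ≺-in-prefix = ≺-in-prefix
    ; block-≤ = block-≤ }
    where
      open ≡-Reasoning
      B : Blocks
      B = sptBlock g
      open BlockPosition (assemble-position B τ e)

      gk≡block : g k ≡ block
      gk≡block = ∈-sptBlock⁻ g (subst (k ∈_) (sym block≡) (∈-++⁺ʳ before (here refl)))

      ≺-in-prefix : ∀ {i} → i ≺ k → g i ≤ g k → inj₁ i ∈ xs
      ≺-in-prefix {i} i≺k gi≤gk = subst (inj₁ i ∈_) (sym prefix≡) (in-blocks (m≤n⇒m<n∨m≡n gi≤gk))
        where
          in-blocks : g i < g k ⊎ g i ≡ g k → inj₁ i ∈ blocksBefore B τ block ++ map inj₁ before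
          in-blocks (inj₁ gi<gk) = ∈-++⁺ˡ (∈-blocksBefore⁺ B τ block≤ (subst (g i <_) gk≡block gi<gk)
                                                           (∈-sptBlock⁺ g refl))
          in-blocks (inj₂ gi≡gk) = ∈-++⁺ʳ (blocksBefore B τ block) (∈-map⁺ inj₁
            (sorted-before ≺-asym before (subst Sorted block≡ (sptBlock-sorted g block))
              (subst (i ∈_) block≡ (∈-sptBlock⁺ g (trans gi≡gk gk≡block))) i≺k))

      block-≤ : ∀ {i} → inj₁ i ∈ xs → g i ≤ g k
      block-≤ {i} i∈ with ∈-++⁻ (blocksBefore B τ block) (subst (inj₁ i ∈_) prefix≡ i∈)
      ... | inj₁ i∈bb = let c , c<b , i∈Bc = ∈-blocksBefore⁻ B τ block i∈bb in
                         ≤-trans (≤-reflexive (∈-sptBlock⁻ g i∈Bc))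
                                 (<⇒≤ (subst (c <_) (sym gk≡block) c<b))
      ... | inj₂ i∈before = ≤-reflexive (trans (∈-sptBlock⁻ g (subst (i ∈_) (sym block≡)
                                (∈-++⁺ˡ (∈-map-inj₁⁻ i∈before)))) (sym gk≡block))

  arrange-feasible : ∀ τ g → (∀ y f → T (req y f) → f ∈ take (g y) τ) → Feasible (arrange τ g)
  arrange-feasible τ g setups-ok xs j ys e f r =
    ∈-setups⁻ xs (subst (f ∈_) (sym setups-prefix) (setups-ok j f r))
    where open ArrangedPrefix (arrange-prefix τ g e)

  arrange-GenSPT : ∀ τ g → (∀ i k → i ≺ k → g k < g i → MissingSetup i (take (g k) τ)) →
                   GenSPT (arrange τ g)
  arrange-GenSPT τ g missing i k i≺k xs ys e with g i ≤? g k
  ... | yes gi≤gk = inj₁ (≺-in-prefix i≺k gi≤gk)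
    where open ArrangedPrefix (arrange-prefix τ g e)
  ... | no gi≰gk = inj₂ (Equivalence.from (cannotBeScheduledAfter⇔ xs)
                     (subst (MissingSetup i) (sym setups-prefix) (missing i k i≺k (≰⇒> gi≰gk))))
    where open ArrangedPrefix (arrange-prefix τ g e)

  arrange-feasible⁻ : ∀ τ g → Feasible (arrange τ g) →
                      ∀ {y} → inj₁ y ∈ arrange τ g → ∀ f → T (req y f) → f ∈ take (g y) τ
  arrange-feasible⁻ τ g feasible y∈ f r with ∈-∃++ y∈
  ... | xs , ys , e = subst (f ∈_) setups-prefix (∈-setups⁺ xs (feasible xs _ ys e f r))
    where open ArrangedPrefix (arrange-prefix τ g e)

  arrange-GenSPT⁻ : ∀ τ g → GenSPT (arrange τ g) →
                    ∀ {i k} → inj₁ k ∈ arrange τ g → i ≺ k → g k < g i → MissingSetup i (take (g k) τ)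
  arrange-GenSPT⁻ τ g genSPT {i} {k} k∈ i≺k gk<gi with ∈-∃++ k∈
  ... | xs , ys , e with genSPT i k i≺k xs ys e
  ...   | inj₁ i∈xs = contradiction (block-≤ i∈xs) (<⇒≱ gk<gi)
    where open ArrangedPrefix (arrange-prefix τ g e)
  ...   | inj₂ cannot =
    subst (MissingSetup i) setups-prefix (Equivalence.to (cannotBeScheduledAfter⇔ xs) cannot)
    where open ArrangedPrefix (arrange-prefix τ g e)

  -- Schedules in generalized weighted SPT-order are arranged

  jobsBlock : Schedule n K → Blocks
  jobsBlock [] b = []
  jobsBlock (inj₁ x ∷ σ) zero = x ∷ jobsBlock σ zero
  jobsBlock (inj₁ x ∷ σ) (suc b) = jobsBlock σ (suc b)
  jobsBlock (inj₂ f ∷ σ) zero = []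
  jobsBlock (inj₂ f ∷ σ) (suc b) = jobsBlock σ b

  blockOf : Schedule n K → Fin n → ℕ
  blockOf [] y = 0
  blockOf (inj₁ x ∷ σ) y = if does (y F.≟ x) then 0 else blockOf σ y
  blockOf (inj₂ f ∷ σ) y = suc (blockOf σ y)

  laterBlocks-cong : ∀ τ {B B′} → (∀ b → B (suc b) ≡ B′ (suc b)) → laterBlocks B τ ≡ laterBlocks B′ τ
  laterBlocks-cong [] _ = refl
  laterBlocks-cong (f ∷ τ) B≗B′ = cong (inj₂ f ∷_) (assemble-cong τ B≗B′)

  assemble-jobsBlock : ∀ σ → σ ≡ assemble (jobsBlock σ) (setups σ)
  assemble-jobsBlock [] = refl
  assemble-jobsBlock (inj₁ x ∷ σ) = cong (inj₁ x ∷_) (trans (assemble-jobsBlock σ)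
    (cong (map inj₁ (jobsBlock σ 0) ++_) (laterBlocks-cong (setups σ) λ _ → refl)))
  assemble-jobsBlock (inj₂ f ∷ σ) = cong (inj₂ f ∷_) (assemble-jobsBlock σ)

  jobsBlock⊆ : ∀ σ b {y} → y ∈ jobsBlock σ b → inj₁ y ∈ σ
  jobsBlock⊆ (inj₁ x ∷ σ) zero (here refl) = here refl
  jobsBlock⊆ (inj₁ x ∷ σ) zero (there y∈) = there (jobsBlock⊆ σ zero y∈)
  jobsBlock⊆ (inj₁ x ∷ σ) (suc b) y∈ = there (jobsBlock⊆ σ (suc b) y∈)
  jobsBlock⊆ (inj₂ f ∷ σ) (suc b) y∈ = there (jobsBlock⊆ σ b y∈)

  ∈-jobsBlock⁻ : ∀ σ {b y} → Unique σ → y ∈ jobsBlock σ b → blockOf σ y ≡ b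
  ∈-jobsBlock⁻ (inj₁ x ∷ σ) {b} {y} (x∉σ ∷ uσ) y∈ with y F.≟ x | b | y∈
  ... | yes refl | zero | _ = refl
  ... | yes refl | suc b | y∈′ = contradiction refl (All.lookup x∉σ (jobsBlock⊆ σ (suc b) y∈′))
  ... | no y≢x | zero | here y≡x = contradiction y≡x y≢x
  ... | no _ | zero | there y∈′ = ∈-jobsBlock⁻ σ uσ y∈′
  ... | no _ | suc b | y∈′ = ∈-jobsBlock⁻ σ uσ y∈′
  ∈-jobsBlock⁻ (inj₂ f ∷ σ) {suc b} (_ ∷ uσ) y∈ = cong suc (∈-jobsBlock⁻ σ uσ y∈)

  ∈-jobsBlock⁺ : ∀ σ {y} → inj₁ y ∈ σ → y ∈ jobsBlock σ (blockOf σ y)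
  ∈-jobsBlock⁺ (inj₁ x ∷ σ) {y} y∈ with y F.≟ x | y∈
  ... | yes refl | _ = here refl
  ... | no y≢x | here refl = contradiction refl y≢x
  ... | no _ | there y∈σ = into-block (blockOf σ y) (∈-jobsBlock⁺ σ y∈σ)
    where
      into-block : ∀ c → y ∈ jobsBlock σ c → y ∈ jobsBlock (inj₁ x ∷ σ) c
      into-block zero = there
      into-block (suc c) = id
  ∈-jobsBlock⁺ (inj₂ f ∷ σ) (there y∈σ) = ∈-jobsBlock⁺ σ y∈σ

  blockOf-≤ : ∀ σ y → blockOf σ y ≤ length (setups σ)
  blockOf-≤ [] y = z≤n
  blockOf-≤ (inj₁ x ∷ σ) y with y F.≟ x
  ... | yes _ = z≤n
  ... | no _ = blockOf-≤ σ y
  blockOf-≤ (inj₂ f ∷ σ) y = s≤s (blockOf-≤ σ y)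

  module _ {ρ : Schedule n K} (feasible : Feasible ρ) (genSPT : GenSPT ρ) (unique : Unique ρ) where

    private
      shift : ∀ pre {o σ} → ρ ≡ pre ++ o ∷ σ → ρ ≡ pre ∷ʳ o ++ σ
      shift pre {o} {σ} e = trans e (sym (∷ʳ-++ pre o σ))

    -- If y ≺ x, the job y misses a setup in front of x, yet feasibility provides it in front of y.
    adjacent-jobs-≺ : ∀ xs {x y ys} → ρ ≡ xs ++ inj₁ x ∷ inj₁ y ∷ ys → x ≺ y
    adjacent-jobs-≺ xs {x} {y} {ys} e with ≺-compare x y x≢y
      where
        x≢y : x ≢ y
        x≢y refl = proj₂ (Unique-++-∷⁻ xs (subst Unique e unique)) (here refl)
    ... | inj₁ x≺y = x≺y
    ... | inj₂ y≺x with genSPT y x y≺x xs (inj₁ y ∷ ys) e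
    ...   | inj₁ y∈xs = ⊥-elim (proj₁ (Unique-++-∷⁻ (xs ∷ʳ inj₁ x) (subst Unique (shift xs e) unique))
                                      (∈-++⁺ˡ y∈xs))
    ...   | inj₂ (f , r , f∉xs) with ∈-++⁻ xs (feasible (xs ∷ʳ inj₁ x) y ys (shift xs e) f r)
    ...     | inj₁ f∈xs = contradiction f∈xs f∉xs
    ...     | inj₂ (here ())

    jobsBlock-linked : ∀ pre σ → ρ ≡ pre ++ σ → ∀ b → Linked _≺_ (jobsBlock σ b)
    jobsBlock-linked pre [] _ b = []
    jobsBlock-linked pre (inj₁ x ∷ []) _ zero = [-]
    jobsBlock-linked pre (inj₁ x ∷ inj₂ f ∷ σ) _ zero = [-]
    jobsBlock-linked pre (inj₁ x ∷ inj₁ y ∷ σ) e zero =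
      adjacent-jobs-≺ pre e ∷ jobsBlock-linked (pre ∷ʳ inj₁ x) (inj₁ y ∷ σ) (shift pre e) zero
    jobsBlock-linked pre (inj₁ x ∷ σ) e (suc b) =
      jobsBlock-linked (pre ∷ʳ inj₁ x) σ (shift pre e) (suc b)
    jobsBlock-linked pre (inj₂ f ∷ σ) _ zero = []
    jobsBlock-linked pre (inj₂ f ∷ σ) e (suc b) = jobsBlock-linked (pre ∷ʳ inj₂ f) σ (shift pre e) b

  canonical-form : ∀ {σ} → Unique σ → (∀ y → inj₁ y ∈ σ) → Feasible σ → GenSPT σ →
                   σ ≡ arrange (setups σ) (blockOf σ)
  canonical-form {σ} unique complete feasible genSPT =
    trans (assemble-jobsBlock σ) (assemble-cong (setups σ) λ b →
      sorted-unique ≺-asym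
        (Linked⇒AllPairs ≺-trans (jobsBlock-linked feasible genSPT unique [] σ refl b))
        (sptBlock-sorted (blockOf σ) b)
        λ y → mk⇔ (∈-sptBlock⁺ (blockOf σ) ∘ ∈-jobsBlock⁻ σ unique)
                  (λ y∈ → subst (λ c → y ∈ jobsBlock σ c) (∈-sptBlock⁻ (blockOf σ) y∈)
                                (∈-jobsBlock⁺ σ (complete y))))

  allOps-unique : Unique allOps
  allOps-unique =
    Uniqueₚ.++⁺ (Uniqueₚ.map⁺ inj₁-injective (allFin⁺ n)) (Uniqueₚ.map⁺ inj₂-injective (allFin⁺ K))
    λ (v∈jobs , v∈setups) → case (∈-map⁻ inj₁ v∈jobs , ∈-map⁻ inj₂ v∈setups) of
      λ { ((_ , _ , refl) , (_ , _ , ())) }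

  module Reconstruction {π : Schedule n K} (π↭ : IsPermSchedule π) (feasible : Feasible π)
                        (genSPT : GenSPT π) (τ↭ : setups π ↭ allFin K) where

    τ : List (Fin K)
    τ = setups π

    target : Fin n → ℕ
    target = blockOf π

    π-complete : ∀ y → inj₁ y ∈ π
    π-complete y = ∈-resp-↭ (↭-sym π↭) (∈-++⁺ˡ (∈-map⁺ inj₁ (∈-allFin y)))

    π-canonical : π ≡ arrange τ target
    π-canonical =
      canonical-form (Unique-resp-↭ (↭⇒↭ₛ (↭-sym π↭)) allOps-unique) π-complete feasible genSPT

    target-setups : ∀ y f → T (req y f) → f ∈ take (target y) τ
    target-setups y = arrange-feasible⁻ τ target (subst Feasible π-canonical feasible)
                                           (subst (inj₁ y ∈_) π-canonical (π-complete y))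

    target-missing : ∀ {i k} → i ≺ k → target k < target i → MissingSetup i (take (target k) τ)
    target-missing {k = k} = arrange-GenSPT⁻ τ target (subst GenSPT π-canonical genSPT)
                                              (subst (inj₁ k ∈_) π-canonical (π-complete k))

    β : Fin n → Fin (suc K)
    β y = fromℕ< (s≤s (subst (target y ≤_) length-τ (blockOf-≤ π y)))
      where
        length-τ : length τ ≡ K
        length-τ = trans (↭-length τ↭) (length-tabulate id)

    toℕ-β : ∀ y → toℕ (β y) ≡ target y
    toℕ-β y = toℕ-fromℕ< _

    stage : ℕ → Fin n → ℕ
    stage k = overrideOn (take k sptOrder) (toℕ ∘ β) (const (length τ))

    applyMoves-πinit : ∀ js →
      applyMoves β js (πinit τ) ≡ arrange τ (overrideOn js (toℕ ∘ β) (const (length τ)))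
    applyMoves-πinit js = trans (cong (applyMoves β js) (πinit-arrange τ))
      (applyMoves-arrange β js τ _ λ j → subst (_≤ length τ) (sym (toℕ-β j)) (blockOf-≤ π j))

    stage-cases : ∀ k y → (y ∈ take k sptOrder × stage k y ≡ target y)
                        ⊎ (y ∉ take k sptOrder × stage k y ≡ length τ)
    stage-cases k y = Sum.map (λ y∈ → y∈ , trans (overrideOn-∈ (toℕ ∘ β) _ y∈) (toℕ-β y))
                                   (λ y∉ → y∉ , overrideOn-∉ (toℕ ∘ β) _ y∉)
                                   (toSum (y ∈? take k sptOrder))

    stage-≤ : ∀ k y → stage k y ≤ length τ
    stage-≤ k y with stage-cases k y
    ... | inj₁ (_ , stage≡target) = subst (_≤ length τ) (sym stage≡target) (blockOf-≤ π y)
    ... | inj₂ (_ , stage≡last) = ≤-reflexive stage≡last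

    stage-setups : ∀ k y f → T (req y f) → f ∈ take (stage k y) τ
    stage-setups k y f r with stage-cases k y
    ... | inj₁ (_ , stage≡target) = subst (λ b → f ∈ take b τ) (sym stage≡target) (target-setups y f r)
    ... | inj₂ (_ , stage≡last) = subst (λ b → f ∈ take b τ) (sym stage≡last)
            (subst (f ∈_) (sym (take-all (length τ) τ ≤-refl)) (∈-resp-↭ (↭-sym τ↭) (∈-allFin f)))

    stage-missing : ∀ k {i l} → i ≺ l → stage k l < stage k i → MissingSetup i (take (stage k l) τ)
    stage-missing k {i} {l} i≺l l<i with stage-cases k l | stage-cases k i
    ... | inj₂ (_ , l≡last) | _ = contradiction (stage-≤ k i) (<⇒≱ (subst (_< stage k i) l≡last l<i))
    ... | inj₁ (l∈ , _) | inj₂ (i∉ , _) = contradiction i≺l (≺-asym (take-sptOrder-≺ k l∈ i∉))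
    ... | inj₁ (_ , l≡target) | inj₁ (_ , i≡target) =
      subst (λ b → MissingSetup i (take b τ)) (sym l≡target)
            (target-missing i≺l (subst₂ _<_ l≡target i≡target l<i))

    stage-feasible : ∀ k → Feasible (applyMoves β (take k sptOrder) (πinit τ))
    stage-feasible k = subst Feasible (sym (applyMoves-πinit (take k sptOrder)))
                             (arrange-feasible τ (stage k) (stage-setups k))

    stage-GenSPT : ∀ k → GenSPT (applyMoves β (take k sptOrder) (πinit τ))
    stage-GenSPT k = subst GenSPT (sym (applyMoves-πinit (take k sptOrder)))
                           (arrange-GenSPT τ (stage k) λ _ _ → stage-missing k)

    applyMoves-all : applyMoves β sptOrder (πinit τ) ≡ π
    applyMoves-all = begin
      applyMoves β sptOrder (πinit τ)                               ≡⟨ applyMoves-πinit sptOrder ⟩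
      arrange τ (overrideOn sptOrder (toℕ ∘ β) (const (length τ))) ≡⟨ arrange-cong τ moved-to-target ⟩
      arrange τ target                                              ≡⟨ sym π-canonical ⟩
      π                                                             ∎
      where
        open ≡-Reasoning
        moved-to-target : ∀ y → overrideOn sptOrder (toℕ ∘ β) (const (length τ)) y ≡ target y
        moved-to-target y = trans (overrideOn-∈ (toℕ ∘ β) _ (∈-sptOrder y)) (toℕ-β y)

lemma4 : ∀ {n K : ℕ} (p w : Fin n → ℕ) (req : Fin n → Fin K → Bool)
    (τ : List (Fin K)) → τ ↭ allFin K →
    (π : Schedule n K) →
    Sched.IsPermSchedule p w req π →
    Sched.Feasible p w req π →
    Sched.GenSPT p w req π →
    Sched.setups p w req π ≡ τ →
    Σ (Fin n → Fin (suc K)) (λ β →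
      ((k : ℕ) → k ≤ n →
        Sched.Feasible p w req
          (Sched.applyMoves p w req β (take k (Sched.sptOrder p w req)) (Sched.πinit p w req τ))
        × Sched.GenSPT p w req
          (Sched.applyMoves p w req β (take k (Sched.sptOrder p w req)) (Sched.πinit p w req τ)))
      × Sched.applyMoves p w req β (Sched.sptOrder p w req) (Sched.πinit p w req τ) ≡ π)
lemma4 p w req τ τ↭ π π↭ feasible genSPT refl =
  β , (λ k _ → stage-feasible k , stage-GenSPT k) , applyMoves-all
  where open Scheduling.Reconstruction p w req π↭ feasible genSPT τ↭
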